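{- Let $\to$ be a binary relation on a set $S$. Then: (i) for every $\mathsf X\subseteq\{\mathsf t,\mathsf b,\mathsf 4,\mathsf 5\}$ there exists a least relation $\to^{\mathsf X}$ (w.r.t. inclusion) on $S$ which contains $\to$ and has all the properties named in $\mathsf X$; (ii) the relation $\to\cup\to_5$ is the least euclidean relation containing $\to$; (iii) the relation $\to_{45}$ is the least transitive and euclidean relation containing $\to$.
   Context: Properties: $\mathsf t$ reflexive, $\mathsf b$ symmetric, $\mathsf 4$ transitive, $\mathsf 5$ euclidean (for all $s,t,u$: $s\to t$ and $s\to u$ imply $t\to u$). Write $\leftarrow$ for the inverse of $\to$ and $\leftrightarrow$ for its symmetric closure. A euclidean connection for $\to$ from $s$ to $t$ is a nonempty sequence $s_1,\dots,s_n$ of elements of $S$ with $s\leftarrow s_1\leftrightarrow s_2\leftrightarrow\dots\leftrightarrow s_n\to t$; a transitive-euclidean connection from $s$ to $t$ is a nonempty sequence $s_1,\dots,s_n$ with $s=s_1\leftrightarrow s_2\leftrightarrow\dots\leftrightarrow s_n\to t$. We write $s\to_5 t$ (resp. $s\to_{45}t$) if there is a euclidean (resp. transitive-euclidean) connection for $\to$ from $s$ to $t$. -}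

module Defs where

open import Data.Bool using (Bool; T)
open import Data.Product using (Σ; ∃; _×_; _,_)
open import Data.Sum using (_⊎_)
open import Level using (0ℓ; suc)
open import Relation.Binary.Core using (Rel; _⇒_)
open import Relation.Binary.Definitions using (Reflexive; Symmetric; Transitive)
open import Relation.Binary.Construct.Closure.Symmetric using (SymClosure)
open import Relation.Binary.Construct.Closure.ReflexiveTransitive using (Star)

Euclidean : {S : Set} → Rel S 0ℓ → Set
Euclidean _R_ = ∀ {s t u} → s R t → s R u → t R u

data Property : Set where
  𝐭 𝐛 𝟒 𝟓 : Property

HasProperty : {S : Set} → Property → Rel S 0ℓ → Set
HasProperty 𝐭 R = Reflexive R
HasProperty 𝐛 R = Symmetric R
HasProperty 𝟒 R = Transitive R
HasProperty 𝟓 R = Euclidean R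

PropSet : Set
PropSet = Property → Bool

HasAll : {S : Set} → PropSet → Rel S 0ℓ → Set
HasAll X R = ∀ p → T (X p) → HasProperty p R

IsLeast : {S : Set} → (Rel S 0ℓ → Set) → Rel S 0ℓ → Set₁
IsLeast P R = P R × (∀ (R′ : Rel _ 0ℓ) → P R′ → R ⇒ R′)

ContainingWith : {S : Set} → Rel S 0ℓ → (Rel S 0ℓ → Set) → Rel S 0ℓ → Set
ContainingWith _⟶_ Q R = (_⟶_ ⇒ R) × Q R

_⟶[_]₅_ : {S : Set} → S → Rel S 0ℓ → S → Set
s ⟶[ _⟶_ ]₅ t = ∃ λ s₁ → ∃ λ sₙ →
  (s₁ ⟶ s) × Star (SymClosure _⟶_) s₁ sₙ × (sₙ ⟶ t)

_⟶[_]₄₅_ : {S : Set} → S → Rel S 0ℓ → S → Set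
s ⟶[ _⟶_ ]₄₅ t = ∃ λ sₙ → Star (SymClosure _⟶_) s sₙ × (sₙ ⟶ t)

-- The closure in (i) is generated inductively by the rules of the properties in X.
-- For (ii) and (iii), both explicit relations are closed under their properties
-- because two connections leaving a common point can be glued, one of them reversed,
-- into a euclidean connection between their endpoints. Conversely, a relation R that
-- is transitive and euclidean absorbs every step of a transitive-euclidean connection
-- of R; a merely euclidean R absorbs a euclidean connection s ← s₁ ↔ … ↔ sₙ → t
-- because the successors of every sᵢ are successors of s.
module Submission where

open import Defs
open import Data.Product using (∃; _×_; _,_)
open import Data.Sum using (_⊎_; inj₁; inj₂; [_,_])
open import Data.Bool using (T)
open import Function using (_∘_)
open import Level using (0ℓ)
open import Relation.Binary.Core using (Rel; _⇒_)
open import Relation.Binary.Definitions using (Transitive)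
open import Relation.Unary using (_⊆_)
open import Relation.Binary.Construct.Closure.Symmetric as SymClosure
  using (SymClosure; fwd; bwd)
open import Relation.Binary.Construct.Closure.ReflexiveTransitive as Star
  using (Star; ε; _◅_; _◅◅_)

module _ {S : Set} where

  Zigzag : Rel S 0ℓ → Rel S 0ℓ
  Zigzag R = Star (SymClosure R)

  zigzag-reverse : ∀ {R : Rel S 0ℓ} {s t} → Zigzag R s t → Zigzag R t s
  zigzag-reverse {R} = Star.reverse (SymClosure.symmetric R)

  zigzag-mono : ∀ {P Q : Rel S 0ℓ} → P ⇒ Q → Zigzag P ⇒ Zigzag Q
  zigzag-mono P⇒Q = Star.map (SymClosure.map P⇒Q)

  ⟶₅-mono : ∀ {P Q : Rel S 0ℓ} {s t} → P ⇒ Q → s ⟶[ P ]₅ t → s ⟶[ Q ]₅ t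
  ⟶₅-mono P⇒Q (s₁ , sₙ , s₁s , path , sₙt) =
    s₁ , sₙ , P⇒Q s₁s , zigzag-mono P⇒Q path , P⇒Q sₙt

  ⟶₄₅-mono : ∀ {P Q : Rel S 0ℓ} {s t} → P ⇒ Q → s ⟶[ P ]₄₅ t → s ⟶[ Q ]₄₅ t
  ⟶₄₅-mono P⇒Q (sₙ , path , sₙt) = sₙ , zigzag-mono P⇒Q path , P⇒Q sₙt

  module _ {R : Rel S 0ℓ} (euclidean : Euclidean R) where

    euclidean-successors-⊆ : ∀ {x y} → R x y → R x ⊆ R y
    euclidean-successors-⊆ xy xz = euclidean xy xz

    -- In the forward case a → c: s sees c, and as s R s, euclideanity gives c R s.
    zigzag-successors-⊆ : ∀ {s a b} → R s s → R a ⊆ R s → Zigzag R a b → R b ⊆ R s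
    zigzag-successors-⊆ s↺ Ra⊆Rs ε = Ra⊆Rs
    zigzag-successors-⊆ s↺ Ra⊆Rs (fwd ac ◅ path) =
      zigzag-successors-⊆ s↺ (euclidean-successors-⊆ (euclidean (Ra⊆Rs ac) s↺)) path
    zigzag-successors-⊆ s↺ Ra⊆Rs (bwd ca ◅ path) =
      zigzag-successors-⊆ s↺ (Ra⊆Rs ∘ euclidean-successors-⊆ ca) path

    euclidean-⟶₅-closed : ∀ {s t} → s ⟶[ R ]₅ t → R s t
    euclidean-⟶₅-closed (s₁ , sₙ , s₁s , path , sₙt) =
      zigzag-successors-⊆ (euclidean s₁s s₁s) (euclidean-successors-⊆ s₁s) path sₙt

  transitive-euclidean-⟶₄₅-closed : ∀ {R : Rel S 0ℓ} → Transitive R → Euclidean R →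
                                    ∀ {s t} → s ⟶[ R ]₄₅ t → R s t
  transitive-euclidean-⟶₄₅-closed {R} transitive euclidean {t = t} (sₙ , path , sₙt) = go path
    where
    go : ∀ {s} → Zigzag R s sₙ → R s t
    go ε               = sₙt
    go (fwd sa ◅ path) = transitive sa (go path)
    go (bwd as ◅ path) = euclidean as (go path)

module _ {S : Set} (_⟶_ : Rel S 0ℓ) where

  data Closure (X : PropSet) : Rel S 0ℓ where
    inj   : ∀ {s t} → s ⟶ t → Closure X s t
    refl  : T (X 𝐭) → ∀ {s} → Closure X s s
    sym   : T (X 𝐛) → ∀ {s t} → Closure X s t → Closure X t s
    trans : T (X 𝟒) → ∀ {s t u} → Closure X s t → Closure X t u → Closure X s u
    eucl  : T (X 𝟓) → ∀ {s t u} → Closure X s t → Closure X s u → Closure X t u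

  closure-hasAll : ∀ X → HasAll X (Closure X)
  closure-hasAll X 𝐭 = refl
  closure-hasAll X 𝐛 = sym
  closure-hasAll X 𝟒 = trans
  closure-hasAll X 𝟓 = eucl

  closure-least : ∀ X (R : Rel S 0ℓ) → ContainingWith _⟶_ (HasAll X) R → Closure X ⇒ R
  closure-least X R (⟶⇒R , hasAll) = go
    where
    go : Closure X ⇒ R
    go (inj st)        = ⟶⇒R st
    go (refl x)        = hasAll 𝐭 x
    go (sym x st)      = hasAll 𝐛 x (go st)
    go (trans x st tu) = hasAll 𝟒 x (go st) (go tu)
    go (eucl x st su)  = hasAll 𝟓 x (go st) (go su)

  closure-isLeast : ∀ X → IsLeast (ContainingWith _⟶_ (HasAll X)) (Closure X)
  closure-isLeast X = (inj , closure-hasAll X) , closure-least X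

  _⟶₅_ _⟶₄₅_ : Rel S 0ℓ
  s ⟶₅ t = s ⟶[ _⟶_ ]₅ t
  s ⟶₄₅ t = s ⟶[ _⟶_ ]₄₅ t

  ⟶⇒⟶₄₅ : _⟶_ ⇒ _⟶₄₅_
  ⟶⇒⟶₄₅ st = _ , ε , st

  ⟶₅⇒⟶₄₅ : _⟶₅_ ⇒ _⟶₄₅_
  ⟶₅⇒⟶₄₅ (s₁ , sₙ , s₁s , path , sₙt) = sₙ , bwd s₁s ◅ path , sₙt

  ⟶₄₅-trans : Transitive _⟶₄₅_
  ⟶₄₅-trans (a , sa , at) (b , tb , bu) = b , sa ◅◅ fwd at ◅ tb , bu

  ⟶₄₅-glue : ∀ {s t u} → s ⟶₄₅ t → s ⟶₄₅ u → t ⟶₅ u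
  ⟶₄₅-glue (a , sa , at) (b , sb , bu) = a , b , at , zigzag-reverse sa ◅◅ sb , bu

  ⟶₄₅-euclidean : Euclidean _⟶₄₅_
  ⟶₄₅-euclidean st su = ⟶₅⇒⟶₄₅ (⟶₄₅-glue st su)

  ⟶∪⟶₅-euclidean : Euclidean (λ s t → (s ⟶ t) ⊎ (s ⟶₅ t))
  ⟶∪⟶₅-euclidean st su = inj₂ (⟶₄₅-glue (toConnection st) (toConnection su))
    where
    toConnection : ∀ {s t} → (s ⟶ t) ⊎ (s ⟶₅ t) → s ⟶₄₅ t
    toConnection = [ ⟶⇒⟶₄₅ , ⟶₅⇒⟶₄₅ ]

  ⟶∪⟶₅-isLeast : IsLeast (ContainingWith _⟶_ Euclidean) (λ s t → (s ⟶ t) ⊎ (s ⟶₅ t))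
  ⟶∪⟶₅-isLeast = (inj₁ , ⟶∪⟶₅-euclidean) , least
    where
    least : ∀ R → ContainingWith _⟶_ Euclidean R → (λ s t → (s ⟶ t) ⊎ (s ⟶₅ t)) ⇒ R
    least R (⟶⇒R , euclidean) = [ ⟶⇒R , euclidean-⟶₅-closed euclidean ∘ ⟶₅-mono ⟶⇒R ]

  ⟶₄₅-isLeast : IsLeast (ContainingWith _⟶_ (λ R → Transitive R × Euclidean R)) _⟶₄₅_
  ⟶₄₅-isLeast = (⟶⇒⟶₄₅ , ⟶₄₅-trans , ⟶₄₅-euclidean) , least
    where
    least : ∀ R → ContainingWith _⟶_ (λ R → Transitive R × Euclidean R) R → _⟶₄₅_ ⇒ R
    least R (⟶⇒R , transitive , euclidean) =
      transitive-euclidean-⟶₄₅-closed transitive euclidean ∘ ⟶₄₅-mono ⟶⇒R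

lemma2p17 : (S : Set) (_⟶_ : Rel S 0ℓ) →
    (∀ (X : PropSet) → ∃ λ (R : Rel S 0ℓ) → IsLeast (ContainingWith _⟶_ (HasAll X)) R)
    × IsLeast (ContainingWith _⟶_ Euclidean) (λ s t → (s ⟶ t) ⊎ (s ⟶[ _⟶_ ]₅ t))
    × IsLeast (ContainingWith _⟶_ (λ R → Transitive R × Euclidean R)) (λ s t → s ⟶[ _⟶_ ]₄₅ t)
lemma2p17 S _⟶_ =
    (λ X → Closure _⟶_ X , closure-isLeast _⟶_ X)
  , ⟶∪⟶₅-isLeast _⟶_
  , ⟶₄₅-isLeast _⟶_
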